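{- Let $1\le k\le n$, let $S$ be a totally ordered set with $|S|=n$, and let $C$ be a division of $S$ with $(|C_1|,\dots,|C_n|)=(0^{k-1},n,0^{n-k})$. Suppose the sequence $s_1s_2\dots s_i$ is admissible with respect to $C$, and let $j$ be the index such that $s_i\in C^{s_1\dots s_{i-1}}_j$. Then the sequence $s_1s_2\dots s_i$ has exactly $k-j$ descents.
   Context: $0^l$ denotes $l$ zeros; a descent of a sequence $a_1,a_2,\dots$ is an index $t$ with $a_t>a_{t+1}$. A division of $S$ is a sequence $C=(C_1,\dots,C_n)$ of pairwise disjoint (possibly empty) sets with union $S$ and $s<t$ whenever $s\in C_i,t\in C_j,i<j$. An element $s$ is admissible w.r.t. a division $D=(D_1,\dots,D_N)$ if it is the smallest element of $D_1$, the largest element of $D_N$, or lies in $D_i$ with $i\ne1,N$. For admissible $s\in D_i$, with $D_i^-=\{t\in D_i:t<s\}$, $D_i^+=\{t\in D_i:t>s\}$, the deletion $D^s$ is: if $i=1$, $(D_1^+\cup D_2,D_3,\dots,D_N)$; if $i\ne1,N$, $(D_1,\dots,D_{i-2},D_{i-1}\cup D_i^-,D_i^+\cup D_{i+1},D_{i+2},\dots,D_N)$; if $i=N$, $(D_1,\dots,D_{N-2},D_{N-1}\cup D_N^-)$. A sequence $s_1\dots s_i$ is admissible w.r.t. $C$ if $s_1$ is admissible w.r.t. $C$, $s_2$ w.r.t. $C^{s_1}$, $s_3$ w.r.t. $C^{s_1s_2}=(C^{s_1})^{s_2}$, etc.; $C^{s_1\dots s_{i-1}}$ denotes the result of the successive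 deletions (equal to $C$ if $i=1$). -}

module Defs where

open import Data.Nat using (ℕ; zero; suc; _+_; _∸_; _≤_; _<_; _≟_)
open import Data.Nat.Properties using (_<?_)
open import Data.List using (List; []; _∷_; _++_; length; replicate; take; drop; filter)
open import Data.List.Membership.Propositional using (_∈_)
open import Data.List.Relation.Unary.All using (All)
open import Data.Product using (_×_)
open import Data.Sum using (_⊎_)
open import Relation.Nullary using (yes; no)
open import Relation.Nullary.Decidable using (⌊_⌋)
open import Data.Bool using (if_then_else_)
open import Relation.Binary.PropositionalEquality using (_≡_)

-- A division D = (D_1,…,D_N) is a list of blocks; each block is a list of
-- elements (sets are represented by ascending lists of naturals).
Division : Set
Division = List (List ℕ)

-- the i-th block (1-based); [] when out of range (never used in that case)
blk : Division → ℕ → List ℕ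
blk []       _             = []
blk (B ∷ D)  zero          = []
blk (B ∷ D)  (suc zero)    = B
blk (B ∷ D)  (suc (suc i)) = blk D (suc i)

below : ℕ → List ℕ → List ℕ
below s B = filter (λ t → t <? s) B

above : ℕ → List ℕ → List ℕ
above s B = filter (λ t → s <? t) B

Admissible : Division → ℕ → ℕ → Set
Admissible D s i =
    (i ≡ 1 × s ∈ blk D 1 × All (s ≤_) (blk D 1))
  ⊎ (i ≡ length D × 1 ≤ i × s ∈ blk D i × All (_≤ s) (blk D i))
  ⊎ (1 < i × i < length D × s ∈ blk D i)

del : Division → ℕ → ℕ → Division
del D s i with i ≟ 1
... | yes _ = (above s (blk D 1) ++ blk D 2) ∷ drop 2 D
... | no _ with i ≟ length D
...   | yes _ = take (i ∸ 2) D ++ ((blk D (i ∸ 1) ++ below s (blk D i)) ∷ [])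
...   | no _  = take (i ∸ 2) D
                 ++ ((blk D (i ∸ 1) ++ below s (blk D i))
                     ∷ (above s (blk D i) ++ blk D (suc i)) ∷ [])
                 ++ drop (suc i) D

-- AdmSeq D (s_1 … s_i) j : the sequence is admissible w.r.t. D, and
-- s_i lies in block j of D^{s_1 … s_{i-1}}.
data AdmSeq : Division → List ℕ → ℕ → Set where
  last : ∀ {D s j} → Admissible D s j → AdmSeq D (s ∷ []) j
  step : ∀ {D s i ss j} → Admissible D s i → AdmSeq (del D s i) ss j
       → AdmSeq D (s ∷ ss) j

descents : List ℕ → ℕ
descents [] = 0
descents (a ∷ []) = 0
descents (a ∷ b ∷ as) = (if ⌊ b <? a ⌋ then 1 else 0) + descents (b ∷ as)

initDiv : (n k : ℕ) → List ℕ → Division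
initDiv n k S = replicate (k ∸ 1) [] ++ (S ∷ replicate (n ∸ k) [])

-- Deleting s from D_i leaves every element smaller than s in block i - 1
-- and every larger one in block i, provided that before the deletion each
-- element lay in block i - 1 (if smaller than s), i, or i + 1 (if larger).
-- That split configuration implies the proviso for the next deleted
-- element s', so it is invariant; and it places s' in block i - 1 exactly
-- when s' < s.  Hence the block index drops by one at each descent and
-- stays put otherwise, starting from k since all of S lies in C_k.
module Submission where

open import Defs
open import Data.Bool using (if_then_else_)
open import Data.Empty using (⊥-elim)
open import Data.List using (List; []; _∷_; _++_; length; replicate; take; drop)
open import Data.List.Properties using (length-take; length-replicate)
open import Data.List.Membership.Propositional using (_∈_; _∉_)
open import Data.List.Membership.Propositional.Properties using (∈-filter⁻; ∈-++⁻)
open import Data.List.Relation.Unary.AllPairs using (AllPairs)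
open import Data.Nat using (ℕ; zero; suc; _+_; _∸_; _≤_; _<_; z≤n; s≤s; _≟_)
open import Data.Nat.Properties
  using (_<?_; ≤-refl; ≤-trans; <-trans; <-asym; <-irrefl; ≤⇒≯; n≤1+n; m≤n+m; m≤n⇒m≤1+n;
         +-comm; +-assoc; +-identityʳ; m≤n⇒m⊓n≡m)
open import Data.Product using (∃-syntax; _×_; _,_)
open import Data.Sum using (_⊎_; inj₁; inj₂)
open import Relation.Nullary using (yes; no; contradiction)
open import Relation.Nullary.Decidable using (⌊_⌋)
open import Relation.Binary.PropositionalEquality
  using (_≡_; refl; trans; cong; subst; module ≡-Reasoning)

∈-below⁻ : ∀ {s t} B → t ∈ below s B → t ∈ B × t < s
∈-below⁻ {s} B = ∈-filter⁻ (_<? s) {xs = B}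

∈-above⁻ : ∀ {s t} B → t ∈ above s B → t ∈ B × s < t
∈-above⁻ {s} B = ∈-filter⁻ (s <?_) {xs = B}

Admissible⇒∈ : ∀ D {s i} → Admissible D s i → s ∈ blk D i
Admissible⇒∈ _ (inj₁ (refl , s∈ , _))          = s∈
Admissible⇒∈ _ (inj₂ (inj₁ (_ , _ , s∈ , _))) = s∈
Admissible⇒∈ _ (inj₂ (inj₂ (_ , _ , s∈)))     = s∈

∈-blk⇒bounds : ∀ D {i t} → t ∈ blk D i → 1 ≤ i × i ≤ length D
∈-blk⇒bounds []      ()
∈-blk⇒bounds (B ∷ D) {zero} ()
∈-blk⇒bounds (B ∷ D) {suc zero}    _  = s≤s z≤n , s≤s z≤n
∈-blk⇒bounds (B ∷ D) {suc (suc i)} t∈ =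
  let (_ , i<len) = ∈-blk⇒bounds D t∈ in s≤s z≤n , s≤s i<len

∉-blk-replicate : ∀ n {x t} → t ∉ blk (replicate n []) x
∉-blk-replicate zero ()
∉-blk-replicate (suc n) {zero} ()
∉-blk-replicate (suc n) {suc zero} ()
∉-blk-replicate (suc n) {suc (suc x)} t∈ = ∉-blk-replicate n t∈

∈-blk-++⁻ : ∀ A {L x t} → t ∈ blk (A ++ L) x →
  (x ≤ length A × t ∈ blk A x) ⊎ ∃[ r ] (x ≡ length A + suc r × t ∈ blk L (suc r))
∈-blk-++⁻ []      {[]} ()
∈-blk-++⁻ []      {_ ∷ _} {zero} ()
∈-blk-++⁻ []      {_ ∷ _} {suc r} t∈ = inj₂ (r , refl , t∈)
∈-blk-++⁻ (B ∷ A) {x = zero} ()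
∈-blk-++⁻ (B ∷ A) {x = suc zero}    t∈ = inj₁ (s≤s z≤n , t∈)
∈-blk-++⁻ (B ∷ A) {x = suc (suc x)} t∈ with ∈-blk-++⁻ A t∈
... | inj₁ (x<len , t∈A)  = inj₁ (s≤s x<len , t∈A)
... | inj₂ (r , x≡ , t∈L) = inj₂ (r , cong suc x≡ , t∈L)

blk-take : ∀ p D {x} → x ≤ p → blk (take p D) x ≡ blk D x
blk-take zero    []      _ = refl
blk-take (suc p) []      _ = refl
blk-take zero    (B ∷ D) {zero} _ = refl
blk-take (suc p) (B ∷ D) {zero} _ = refl
blk-take (suc p) (B ∷ D) {suc zero} _ = refl
blk-take (suc p) (B ∷ D) {suc (suc x)} (s≤s x<p) = blk-take p D x<p

length-take-≤ : ∀ p (D : Division) → p ≤ length D → length (take p D) ≡ p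
length-take-≤ p D p≤ = trans (length-take p D) (m≤n⇒m⊓n≡m p≤)

∈-blk-take-++⁻ : ∀ p D {L x t} → p ≤ length D → t ∈ blk (take p D ++ L) x →
  (x ≤ p × t ∈ blk D x) ⊎ ∃[ r ] (x ≡ suc (r + p) × t ∈ blk L (suc r))
∈-blk-take-++⁻ p D p≤ t∈ with ∈-blk-++⁻ (take p D) t∈
... | inj₁ (x≤ , t∈′) =
  let x≤p = subst (_ ≤_) (length-take-≤ p D p≤) x≤
  in  inj₁ (x≤p , subst (_ ∈_) (blk-take p D x≤p) t∈′)
... | inj₂ (r , x≡ , t∈′) =
  inj₂ (r , trans x≡ (trans (cong (_+ suc r) (length-take-≤ p D p≤)) (+-comm p (suc r))) , t∈′)

∈-blk-drop⁻ : ∀ q D {r t} → t ∈ blk (drop q D) (suc r) → t ∈ blk D (suc (q + r))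
∈-blk-drop⁻ zero    D       t∈ = t∈
∈-blk-drop⁻ (suc q) []      ()
∈-blk-drop⁻ (suc q) (B ∷ D) t∈ = ∈-blk-drop⁻ q D t∈

-- Moved s i y x t: when s is deleted from D_i, the element t of D_y ends up
-- in block x of D^s.
data Moved (s : ℕ) : (i y x t : ℕ) → Set where
  stay  : ∀ {i x t} → x < i → Moved s i x x t
  down  : ∀ {x t} → t < s → Moved s (suc x) (suc x) x t
  up    : ∀ {i t} → s < t → Moved s i i i t
  shift : ∀ {i x t} → i ≤ x → Moved s i (suc x) x t

∈-lower-merge⁻ : ∀ D {s p t} → t ∈ blk D (suc p) ++ below s (blk D (suc (suc p))) →
  ∃[ y ] (t ∈ blk D y × Moved s (suc (suc p)) y (suc p) t)
∈-lower-merge⁻ D {p = p} t∈ with ∈-++⁻ (blk D (suc p)) t∈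
... | inj₁ t∈D     = suc p , t∈D , stay ≤-refl
... | inj₂ t∈below = let (t∈D , t<s) = ∈-below⁻ (blk D (suc (suc p))) t∈below
                     in  suc (suc p) , t∈D , down t<s

∈-upper-merge⁻ : ∀ D {s i t} → t ∈ above s (blk D i) ++ blk D (suc i) →
  ∃[ y ] (t ∈ blk D y × Moved s i y i t)
∈-upper-merge⁻ D {i = i} t∈ with ∈-++⁻ (above _ (blk D i)) t∈
... | inj₁ t∈above = let (t∈D , s<t) = ∈-above⁻ (blk D i) t∈above in i , t∈D , up s<t
... | inj₂ t∈D     = suc i , t∈D , shift ≤-refl

∈-blk-lower⁻ : ∀ D {s p L x t} → suc (suc p) ≤ length D →
  (∀ {r} → t ∈ blk L (suc r) → ∃[ y ] (t ∈ blk D y × Moved s (suc (suc p)) y (suc (suc (r + p))) t)) →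
  t ∈ blk (take p D ++ (blk D (suc p) ++ below s (blk D (suc (suc p)))) ∷ L) x →
  ∃[ y ] (t ∈ blk D y × Moved s (suc (suc p)) y x t)
∈-blk-lower⁻ D {p = p} i≤len right t∈ with ∈-blk-take-++⁻ p D (≤-trans (m≤n+m p 2) i≤len) t∈
... | inj₁ (x≤p , t∈D)         = _ , t∈D , stay (s≤s (m≤n⇒m≤1+n x≤p))
... | inj₂ (zero , refl , t∈)  = ∈-lower-merge⁻ D t∈
... | inj₂ (suc r , refl , t∈) = right t∈

∈-blk-upper⁻ : ∀ D {s p r t} →
  t ∈ blk ((above s (blk D (suc (suc p))) ++ blk D (suc (suc (suc p)))) ∷ drop (suc (suc (suc p))) D) (suc r) →
  ∃[ y ] (t ∈ blk D y × Moved s (suc (suc p)) y (suc (suc (r + p))) t)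
∈-blk-upper⁻ D {r = zero}  t∈ = ∈-upper-merge⁻ D t∈
∈-blk-upper⁻ D {p = p} {r = suc r} {t} t∈ =
  _ , subst (λ y → t ∈ blk D y) (cong (λ n → suc (suc (suc (suc n)))) (+-comm p r))
            (∈-blk-drop⁻ (suc (suc (suc p))) D t∈)
    , shift (s≤s (s≤s (m≤n+m p (suc r))))

∈-blk-del⁻ : ∀ D s i {x t} → 1 ≤ i → i ≤ length D → t ∈ blk (del D s i) x →
  ∃[ y ] (t ∈ blk D y × Moved s i y x t)
∈-blk-del⁻ D s (suc zero) {zero} _ _ ()
∈-blk-del⁻ D s (suc zero) {suc zero}    _ _ t∈ = ∈-upper-merge⁻ D t∈
∈-blk-del⁻ D s (suc zero) {suc (suc x)} _ _ t∈ = _ , ∈-blk-drop⁻ 2 D t∈ , shift (s≤s z≤n)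
∈-blk-del⁻ D s (suc (suc p)) _ i≤len t∈ with suc (suc p) ≟ length D
... | yes _ = ∈-blk-lower⁻ D i≤len (λ ()) t∈
... | no _  = ∈-blk-lower⁻ D i≤len (∈-blk-upper⁻ D) t∈

-- Where an element t of block x may lie relative to s ∈ D_i, before (Near)
-- and after (Split) the deletion of s.
data Near (s : ℕ) : (i x t : ℕ) → Set where
  before : ∀ {x t} → t < s → Near s (suc x) x t
  inside : ∀ {i t} → Near s i i t
  after  : ∀ {i t} → s < t → Near s i (suc i) t

data Split (s : ℕ) : (i x t : ℕ) → Set where
  before : ∀ {x t} → t < s → Split s (suc x) x t
  after  : ∀ {i t} → s < t → Split s i i t

AllNear : Division → ℕ → ℕ → Set
AllNear D s i = ∀ {x t} → t ∈ blk D x → Near s i x t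

SplitAt : Division → ℕ → ℕ → Set
SplitAt D s i = ∀ {x t} → t ∈ blk D x → Split s i x t

Concentrated : Division → ℕ → Set
Concentrated D k = ∀ {x t} → t ∈ blk D x → x ≡ k

moved-split : ∀ {s i y x t} → Near s i y t → Moved s i y x t → Split s i x t
moved-split (before t<s) (stay _)      = before t<s
moved-split inside       (stay x<x)    = ⊥-elim (<-irrefl refl x<x)
moved-split (after _)    (stay i+1<i)  = ⊥-elim (≤⇒≯ (n≤1+n _) i+1<i)
moved-split _            (down t<s)    = before t<s
moved-split _            (up s<t)      = after s<t
moved-split (before _)   (shift x+2≤x) = ⊥-elim (≤⇒≯ (n≤1+n _) x+2≤x)
moved-split inside       (shift x+1≤x) = ⊥-elim (<-irrefl refl x+1≤x)
moved-split (after s<t)  (shift _)     = after s<t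

split-del : ∀ {D s i} → s ∈ blk D i → AllNear D s i → SplitAt (del D s i) s i
split-del {D} {s} {i} s∈ near t∈ =
  let (1≤i , i≤len)      = ∈-blk⇒bounds D s∈
      (_ , t∈D , moved) = ∈-blk-del⁻ D s i 1≤i i≤len t∈
  in  moved-split (near t∈D) moved

split-near : ∀ {s₀ j i s x t} → Split s₀ j i s → Split s₀ j x t → Near s i x t
split-near (before _)     (before _)     = inside
split-near (before s<s₀)  (after s₀<t)   = after (<-trans s<s₀ s₀<t)
split-near (after s₀<s)   (before t<s₀)  = before (<-trans t<s₀ s₀<s)
split-near (after _)      (after _)      = inside

split-descent : ∀ {s₀ j i s} → Split s₀ j i s → (if ⌊ s <? s₀ ⌋ then 1 else 0) + i ≡ j
split-descent {s₀} {s = s} split with s <? s₀ | split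
... | yes _    | before _    = refl
... | yes s<s₀ | after s₀<s  = contradiction s₀<s (<-asym s<s₀)
... | no _     | after _     = refl
... | no s≮s₀  | before s<s₀ = contradiction s<s₀ s≮s₀

descents-split : ∀ {D s₀ j ss j′} → SplitAt D s₀ j → AdmSeq D ss j′ → descents (s₀ ∷ ss) + j′ ≡ j
descents-split {D} {s₀} {j} {j′ = j′} split (last {s = s} adm) = begin
  (d + 0) + j′ ≡⟨ cong (_+ j′) (+-identityʳ d) ⟩
  d + j′       ≡⟨ split-descent (split (Admissible⇒∈ D adm)) ⟩
  j            ∎
  where open ≡-Reasoning
        d = if ⌊ s <? s₀ ⌋ then 1 else 0
descents-split {D} {s₀} {j} {j′ = j′} split (step {s = s} {i} {ss} adm rest) = begin
  (d + descents (s ∷ ss)) + j′ ≡⟨ +-assoc d (descents (s ∷ ss)) j′ ⟩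
  d + (descents (s ∷ ss) + j′) ≡⟨ cong (d +_) (descents-split (split-del s∈ near) rest) ⟩
  d + i                        ≡⟨ split-descent (split s∈) ⟩
  j                            ∎
  where open ≡-Reasoning
        d = if ⌊ s <? s₀ ⌋ then 1 else 0
        s∈ = Admissible⇒∈ D adm
        near : AllNear D s i
        near t∈ = split-near (split s∈) (split t∈)

concentrated-near : ∀ {D s k} → Concentrated D k → AllNear D s k
concentrated-near conc t∈ with conc t∈
... | refl = inside

descents-concentrated : ∀ {D ss j k} → Concentrated D k → AdmSeq D ss j → descents ss + j ≡ k
descents-concentrated {D} conc (last {j = j} adm) = conc {j} (Admissible⇒∈ D adm)
descents-concentrated {D} conc (step {i = i} adm rest) with conc {i} (Admissible⇒∈ D adm)
... | refl = descents-split (split-del (Admissible⇒∈ D adm) (concentrated-near {D} conc)) rest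

initDiv-concentrated : ∀ n {k} S → 1 ≤ k → Concentrated (initDiv n k S) k
initDiv-concentrated n {suc q} S _ t∈ with ∈-blk-++⁻ (replicate q []) t∈
... | inj₁ (_ , t∈[])        = ⊥-elim (∉-blk-replicate q t∈[])
... | inj₂ (zero , x≡ , _)   = trans x≡ (trans (cong (_+ 1) (length-replicate q)) (+-comm q 1))
... | inj₂ (suc r , _ , t∈[]) = ⊥-elim (∉-blk-replicate (n ∸ suc q) t∈[])

mainTheorem11 : (n k : ℕ) → 1 ≤ k → k ≤ n
    → (S : List ℕ) → AllPairs _<_ S → length S ≡ n
    → (ss : List ℕ) (j : ℕ) → AdmSeq (initDiv n k S) ss j
    → descents ss + j ≡ k
mainTheorem11 n k 1≤k _ S _ _ ss j adm =
  descents-concentrated (initDiv-concentrated n S 1≤k) adm
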